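{- For every positive integer $h$ there exists $N$ such that the following holds. If $G$ is a graph with $|V(G)|\ge N$ which is neither complete nor edgeless, then $G$ contains an induced subgraph $J$ with $|V(J)|=h$ such that $J$ or its complement $\bar{J}$ is a star or has exactly one edge.
   Context: Graphs are finite and simple. A star is a graph $K_{1,m}$ (one vertex adjacent to all others, the others pairwise non-adjacent). -}

module Defs where

open import Data.Nat using (ℕ)
open import Data.Fin using (Fin; _≟_)
open import Data.Bool using (Bool; true; false; not)
open import Data.Product using (_×_; _,_; ∃-syntax)
open import Data.Sum using (_⊎_)
open import Relation.Nullary using (¬_; yes; no)
open import Relation.Binary.PropositionalEquality using (_≡_; _≢_; refl; sym)

record Graph (n : ℕ) : Set where
  field
    adj    : Fin n → Fin n → Bool
    adj-sym    : ∀ u v → adj u v ≡ adj v u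
    adj-irrefl : ∀ v → adj v v ≡ false
open Graph public

Adj : ∀ {n} → Graph n → Fin n → Fin n → Set
Adj G u v = adj G u v ≡ true

compAdj : ∀ {n} → Graph n → Fin n → Fin n → Bool
compAdj G u v with u ≟ v
... | yes _ = false
... | no _  = not (adj G u v)

compAdj-sym : ∀ {n} (G : Graph n) u v → compAdj G u v ≡ compAdj G v u
compAdj-sym G u v with u ≟ v | v ≟ u
... | yes _ | yes _ = refl
... | yes p | no q  = Data.Empty.⊥-elim (q (sym p))
  where import Data.Empty
... | no p  | yes q = Data.Empty.⊥-elim (p (sym q))
  where import Data.Empty
... | no _  | no _  rewrite adj-sym G u v = refl

compAdj-irrefl : ∀ {n} (G : Graph n) v → compAdj G v v ≡ false
compAdj-irrefl G v with v ≟ v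
... | yes _ = refl
... | no p  = Data.Empty.⊥-elim (p refl)
  where import Data.Empty

complement : ∀ {n} → Graph n → Graph n
complement G = record
  { adj = compAdj G ; adj-sym = compAdj-sym G ; adj-irrefl = compAdj-irrefl G }

induced : ∀ {n h} → Graph n → (f : Fin h → Fin n) → Graph h
induced G f = record
  { adj = λ u v → adj G (f u) (f v)
  ; adj-sym = λ u v → adj-sym G (f u) (f v)
  ; adj-irrefl = λ v → adj-irrefl G (f v) }

IsComplete : ∀ {n} → Graph n → Set
IsComplete G = ∀ u v → u ≢ v → Adj G u v

IsEdgeless : ∀ {n} → Graph n → Set
IsEdgeless G = ∀ u v → ¬ Adj G u v

IsStar : ∀ {n} → Graph n → Set
IsStar G = ∃[ c ] ((∀ v → v ≢ c → Adj G c v)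
                  × (∀ u v → u ≢ c → v ≢ c → ¬ Adj G u v))

HasExactlyOneEdge : ∀ {n} → Graph n → Set
HasExactlyOneEdge G = ∃[ a ] ∃[ b ] (Adj G a b ×
  (∀ u v → Adj G u v → (u ≡ a × v ≡ b) ⊎ (u ≡ b × v ≡ a)))

{-# OPTIONS --safe #-}
module Submission where

-- By Ramsey's theorem a graph on at least R(2h-3, 2h-3) vertices has a clique or an independent
-- set S of size 2h-3; as the complement of G is again neither complete nor edgeless, we may take S
-- independent. Choose an edge ab, and let pq be bs for a neighbour s of b in S if there is one,
-- and ab otherwise; in both cases q has no neighbour among the vertices of S that p misses. If p
-- has h-1 neighbours in S they span a star centred at p. Otherwise p misses at least h-2 vertices
-- of S other than itself, and these together with pq induce exactly one edge.

open import Defs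
open import Data.Nat using (ℕ; zero; suc; _≥_; _≤_; _+_; z≤n; s≤s; _≤?_)
open import Data.Nat.Properties
  using (+-suc; +-cancelˡ-≤; +-monoˡ-≤; +-mono-≤; ≤-reflexive; ≤-pred; ≰⇒>; n≤1+n; module ≤-Reasoning)
open import Data.Fin using (Fin; zero; suc; inject≤; _≟_)
open import Data.Fin.Properties using (any?; inject≤-injective)
open import Data.Bool using (Bool; true; false; not)
open import Data.Bool.Properties using (¬-not; not-¬; not-injective) renaming (_≟_ to _≟ᵇ_)
open import Data.List using (List; []; _∷_; length; lookup; filter)
open import Data.List.Properties using (length-tabulate; filter-all)
open import Data.List.Membership.Propositional using (_∈_; find; lose)
open import Data.List.Membership.Propositional.Properties using (∈-lookup; ∈-filter⁻)
open import Data.List.Relation.Binary.Subset.Propositional using (_⊆_)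
open import Data.List.Relation.Unary.Any using (here; there) renaming (any? to anyᴸ?)
open import Data.List.Relation.Unary.All as All using (All; _∷_)
open import Data.List.Relation.Unary.AllPairs using (_∷_)
open import Data.List.Relation.Unary.Unique.Propositional using (Unique; [])
open import Data.List.Relation.Unary.Unique.Propositional.Properties using (filter⁺; allFin⁺)
open import Data.Product using (_×_; _,_; ∃-syntax; proj₁; proj₂; map₂)
open import Data.Sum using (_⊎_; inj₁; inj₂; [_,_]′; swap) renaming (map to map-⊎)
open import Data.Empty using (⊥-elim)
open import Function using (_∘_)
open import Function.Definitions using (Injective)
open import Relation.Nullary using (¬_; yes; no; ¬?)
open import Relation.Nullary.Decidable using (decidable-stable)
open import Relation.Unary using (Pred; Decidable)
open import Relation.Binary.Definitions using (DecidableEquality)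
open import Relation.Binary.PropositionalEquality
  using (_≡_; _≢_; refl; sym; trans; cong; subst; ≢-sym)

m+n≤o+p⇒m≤o⊎n≤p : ∀ {m n o p} → m + n ≤ o + p → m ≤ o ⊎ n ≤ p
m+n≤o+p⇒m≤o⊎n≤p {m} {n} {o} {p} le with m ≤? o
... | yes m≤o = inj₁ m≤o
... | no  m≰o = inj₂ (+-cancelˡ-≤ o n p (begin
  o + n       ≤⟨ n≤1+n (o + n) ⟩
  suc (o + n) ≤⟨ +-monoˡ-≤ n (≰⇒> m≰o) ⟩
  m + n       ≤⟨ le ⟩
  o + p       ∎))
  where open ≤-Reasoning

module _ {A : Set} where

  lookup-injective : ∀ {xs : List A} → Unique xs → ∀ {i j} → lookup xs i ≡ lookup xs j → i ≡ j
  lookup-injective (_    ∷ _)   {zero}  {zero}  _  = refl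
  lookup-injective (x∉xs ∷ _)   {zero}  {suc j} eq = ⊥-elim (All.lookup x∉xs (∈-lookup j) eq)
  lookup-injective (x∉xs ∷ _)   {suc i} {zero}  eq = ⊥-elim (All.lookup x∉xs (∈-lookup i) (sym eq))
  lookup-injective (_    ∷ uxs) {suc i} {suc j} eq = cong suc (lookup-injective uxs eq)

  embed : ∀ {h} (xs : List A) → h ≤ length xs → Fin h → A
  embed xs h≤ i = lookup xs (inject≤ i h≤)

  embed-injective : ∀ {h} {xs : List A} (h≤ : h ≤ length xs) → Unique xs →
    Injective _≡_ _≡_ (embed xs h≤)
  embed-injective h≤ uxs eq = inject≤-injective h≤ h≤ _ _ (lookup-injective uxs eq)

  length-filter-partition : ∀ {ℓ} {P : Pred A ℓ} (P? : Decidable P) xs →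
    length (filter P? xs) + length (filter (¬? ∘ P?) xs) ≡ length xs
  length-filter-partition P? [] = refl
  length-filter-partition P? (x ∷ xs) with P? x
  ... | yes _ = cong suc (length-filter-partition P? xs)
  ... | no  _ = trans (+-suc _ _) (cong suc (length-filter-partition P? xs))

  length-filter-≢ : (_≟_ : DecidableEquality A) (p : A) {xs : List A} → Unique xs →
    length xs ≤ suc (length (filter (λ y → ¬? (y ≟ p)) xs))
  length-filter-≢ _≟_ p {[]}     []            = z≤n
  length-filter-≢ _≟_ p {x ∷ xs} (x∉xs ∷ uxs) with x ≟ p
  ... | yes refl = s≤s (≤-reflexive (sym (cong length (filter-all _ (All.map ≢-sym x∉xs)))))
  ... | no  _    = s≤s (length-filter-≢ _≟_ p uxs)

ramseyBound : ℕ → ℕ → ℕ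
ramseyBound zero    t       = 0
ramseyBound (suc s) zero    = 0
ramseyBound (suc s) (suc t) = suc (ramseyBound s (suc t) + ramseyBound (suc s) t)

StarOrOneEdge : ∀ {h} → Graph h → Set
StarOrOneEdge J = IsStar J ⊎ HasExactlyOneEdge J

StarOrOneEdgeUpToComplement : ∀ {h} → Graph h → Set
StarOrOneEdgeUpToComplement J = IsStar J ⊎ HasExactlyOneEdge J ⊎ StarOrOneEdge (complement J)

module _ {n : ℕ} (G : Graph n) where

  Homogeneous : Bool → List (Fin n) → Set
  Homogeneous c ys = ∀ {x y} → x ∈ ys → y ∈ ys → x ≢ y → adj G x y ≡ c

  HomogeneousIn : Bool → ℕ → List (Fin n) → Set
  HomogeneousIn c m xs = ∃[ ys ] (ys ⊆ xs × Unique ys × m ≤ length ys × Homogeneous c ys)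

  Independent : List (Fin n) → Set
  Independent ys = ∀ {x y} → x ∈ ys → y ∈ ys → adj G x y ≡ false

  homogeneous-false⇒independent : ∀ {ys} → Homogeneous false ys → Independent ys
  homogeneous-false⇒independent H {x} {y} x∈ y∈ with x ≟ y
  ... | yes refl = adj-irrefl G x
  ... | no  x≢y  = H x∈ y∈ x≢y

  independent-⊆ : ∀ {xs ys} → ys ⊆ xs → Independent xs → Independent ys
  independent-⊆ ys⊆xs I x∈ y∈ = I (ys⊆xs x∈) (ys⊆xs y∈)

  homogeneous-∷ : ∀ {c x ys} → (∀ {y} → y ∈ ys → adj G x y ≡ c) → Homogeneous c ys →
    Homogeneous c (x ∷ ys)
  homogeneous-∷ x~ys H (here refl) (here refl) x≢x = ⊥-elim (x≢x refl)
  homogeneous-∷ x~ys H (here refl) (there y∈)  _   = x~ys y∈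
  homogeneous-∷ x~ys H (there x∈)  (here refl) _   = trans (adj-sym G _ _) (x~ys x∈)
  homogeneous-∷ x~ys H (there x∈)  (there y∈)  x≢y = H x∈ y∈ x≢y

  homogeneousIn-⊆ : ∀ {c m xs zs} → xs ⊆ zs → HomogeneousIn c m xs → HomogeneousIn c m zs
  homogeneousIn-⊆ xs⊆zs (ys , ys⊆xs , uys , m≤ , H) = ys , xs⊆zs ∘ ys⊆xs , uys , m≤ , H

  homogeneousIn-∷ : ∀ {c m x xs zs} → All (x ≢_) xs → zs ⊆ xs → (∀ {y} → y ∈ zs → adj G x y ≡ c) →
    HomogeneousIn c m zs → HomogeneousIn c (suc m) (x ∷ xs)
  homogeneousIn-∷ {x = x} {xs} x∉xs zs⊆xs x~zs (ys , ys⊆zs , uys , m≤ , H) =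
    x ∷ ys , x∷ys⊆x∷xs , All.tabulate (All.lookup x∉xs ∘ zs⊆xs ∘ ys⊆zs) ∷ uys , s≤s m≤ ,
    homogeneous-∷ (x~zs ∘ ys⊆zs) H
    where
    x∷ys⊆x∷xs : x ∷ ys ⊆ x ∷ xs
    x∷ys⊆x∷xs (here refl) = here refl
    x∷ys⊆x∷xs (there y∈)  = there (zs⊆xs (ys⊆zs y∈))

  Adj? : ∀ x → Decidable (Adj G x)
  Adj? x y = adj G x y ≟ᵇ true

  neighbours nonNeighbours : Fin n → List (Fin n) → List (Fin n)
  neighbours    x = filter (Adj? x)
  nonNeighbours x = filter (¬? ∘ Adj? x)

  ∈-neighbours⁻ : ∀ x xs {y} → y ∈ neighbours x xs → y ∈ xs × Adj G x y
  ∈-neighbours⁻ x xs = ∈-filter⁻ (Adj? x) {xs = xs}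

  ∈-nonNeighbours⁻ : ∀ x xs {y} → y ∈ nonNeighbours x xs → y ∈ xs × adj G x y ≡ false
  ∈-nonNeighbours⁻ x xs y∈ with ∈-filter⁻ (¬? ∘ Adj? x) {xs = xs} y∈
  ... | y∈xs , x≁y = y∈xs , ¬-not x≁y

  ramsey : ∀ s t {xs} → Unique xs → ramseyBound s t ≤ length xs →
    HomogeneousIn true s xs ⊎ HomogeneousIn false t xs
  ramsey zero    t       _ _ = inj₁ ([] , (λ ()) , [] , z≤n , λ ())
  ramsey (suc s) zero    _ _ = inj₂ ([] , (λ ()) , [] , z≤n , λ ())
  ramsey (suc s) (suc t) {x ∷ xs} (x∉xs ∷ uxs) (s≤s le)
    with m+n≤o+p⇒m≤o⊎n≤p (subst (ramseyBound s (suc t) + ramseyBound (suc s) t ≤_)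
                                 (sym (length-filter-partition (Adj? x) xs)) le)
  ... | inj₁ le₁ =
    map-⊎ (homogeneousIn-∷ x∉xs (proj₁ ∘ ∈-neighbours⁻ x xs) (λ y∈ → proj₂ (∈-neighbours⁻ x xs y∈)))
          (homogeneousIn-⊆ (there ∘ proj₁ ∘ ∈-neighbours⁻ x xs))
          (ramsey s (suc t) (filter⁺ (Adj? x) uxs) le₁)
  ... | inj₂ le₂ =
    map-⊎ (homogeneousIn-⊆ (there ∘ proj₁ ∘ ∈-nonNeighbours⁻ x xs))
          (homogeneousIn-∷ x∉xs (proj₁ ∘ ∈-nonNeighbours⁻ x xs)
                                (λ y∈ → proj₂ (∈-nonNeighbours⁻ x xs y∈)))
          (ramsey (suc s) t (filter⁺ (¬? ∘ Adj? x) uxs) le₂)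

  ¬edgeless⇒edge : ¬ IsEdgeless G → ∃[ a ] ∃[ b ] Adj G a b
  ¬edgeless⇒edge ¬E =
    decidable-stable (any? λ a → any? λ b → Adj? a b) λ ¬∃ → ¬E λ a b a~b → ¬∃ (a , b , a~b)

  Adj⇒≢ : ∀ {x y} → Adj G x y → x ≢ y
  Adj⇒≢ {x} x~x refl with trans (sym x~x) (adj-irrefl G x)
  ... | ()

  false⇒¬Adj : ∀ {x y} → adj G x y ≡ false → ¬ Adj G x y
  false⇒¬Adj = not-¬

  InducedStarOrOneEdge : ℕ → Set
  InducedStarOrOneEdge h = ∃[ f ] (Injective _≡_ _≡_ f × StarOrOneEdge (induced {n} {h} G f))

  inducedStar : ∀ {m x T} → Unique T → Independent T → (∀ {y} → y ∈ T → Adj G x y) → m ≤ length T →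
    ∃[ f ] (Injective _≡_ _≡_ f × IsStar (induced {n} {suc m} G f))
  inducedStar {x = x} {T} uT indT x~T m≤ = f , embed-injective (s≤s m≤) uxT , zero , centre , leaves
    where
    f : Fin _ → Fin n
    f = embed (x ∷ T) (s≤s m≤)
    uxT : Unique (x ∷ T)
    uxT = All.tabulate (Adj⇒≢ ∘ x~T) ∷ uT
    centre : ∀ v → v ≢ zero → Adj (induced G f) zero v
    centre zero    0≢0 = ⊥-elim (0≢0 refl)
    centre (suc i) _   = x~T (∈-lookup _)
    leaves : ∀ u v → u ≢ zero → v ≢ zero → ¬ Adj (induced G f) u v
    leaves zero    _       0≢0 _   = ⊥-elim (0≢0 refl)
    leaves (suc _) zero    _   0≢0 = ⊥-elim (0≢0 refl)
    leaves (suc _) (suc _) _   _   = false⇒¬Adj (indT (∈-lookup _) (∈-lookup _))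

  inducedOneEdge : ∀ {k p q U} → Adj G p q → Unique U → Independent U →
    (∀ {u} → u ∈ U → u ≢ p × adj G p u ≡ false × adj G q u ≡ false) → k ≤ length U →
    ∃[ f ] (Injective _≡_ _≡_ f × HasExactlyOneEdge (induced {n} {suc (suc k)} G f))
  inducedOneEdge {p = p} {q} {U} p~q uU indU away k≤ =
    f , embed-injective (s≤s (s≤s k≤)) upqU , zero , suc zero , p~q , onlyEdge
    where
    f : Fin _ → Fin n
    f = embed (p ∷ q ∷ U) (s≤s (s≤s k≤))
    q≢ : ∀ {u} → u ∈ U → q ≢ u
    q≢ u∈ refl = false⇒¬Adj (proj₁ (proj₂ (away u∈))) p~q
    upqU : Unique (p ∷ q ∷ U)
    upqU = (Adj⇒≢ p~q ∷ All.tabulate (≢-sym ∘ proj₁ ∘ away)) ∷ All.tabulate q≢ ∷ uU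
    p≁ : ∀ i → ¬ Adj G (lookup U i) p
    p≁ i = false⇒¬Adj (trans (adj-sym G _ p) (proj₁ (proj₂ (away (∈-lookup i)))))
    q≁ : ∀ i → ¬ Adj G (lookup U i) q
    q≁ i = false⇒¬Adj (trans (adj-sym G _ q) (proj₂ (proj₂ (away (∈-lookup i)))))
    onlyEdge : ∀ u v → Adj (induced G f) u v → (u ≡ zero × v ≡ suc zero) ⊎ (u ≡ suc zero × v ≡ zero)
    onlyEdge zero          (suc zero)    _ = inj₁ (refl , refl)
    onlyEdge (suc zero)    zero          _ = inj₂ (refl , refl)
    onlyEdge zero          zero          e = ⊥-elim (false⇒¬Adj (adj-irrefl G p) e)
    onlyEdge (suc zero)    (suc zero)    e = ⊥-elim (false⇒¬Adj (adj-irrefl G q) e)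
    onlyEdge zero          (suc (suc _)) e = ⊥-elim (p≁ _ (trans (adj-sym G _ p) e))
    onlyEdge (suc zero)    (suc (suc _)) e = ⊥-elim (q≁ _ (trans (adj-sym G _ q) e))
    onlyEdge (suc (suc _)) zero          e = ⊥-elim (p≁ _ e)
    onlyEdge (suc (suc _)) (suc zero)    e = ⊥-elim (q≁ _ e)
    onlyEdge (suc (suc _)) (suc (suc _)) e = ⊥-elim (false⇒¬Adj (indU (∈-lookup _) (∈-lookup _)) e)

  module _ {k : ℕ} {S : List (Fin n)} (uS : Unique S) (indS : Independent S)
           (bigS : suc (k + k) ≤ length S) where

    outside : Fin n → List (Fin n)
    outside p = filter (λ u → ¬? (u ≟ p)) (nonNeighbours p S)

    ∈-outside⁻ : ∀ {p u} → u ∈ outside p → u ∈ S × u ≢ p × adj G p u ≡ false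
    ∈-outside⁻ {p} u∈ with ∈-filter⁻ (λ u → ¬? (u ≟ p)) {xs = nonNeighbours p S} u∈
    ... | u∈nn , u≢p with ∈-nonNeighbours⁻ p S u∈nn
    ...   | u∈S , p≁u = u∈S , u≢p , p≁u

    k≤outside : ∀ p → length (neighbours p S) ≤ k → k ≤ length (outside p)
    k≤outside p few = +-cancelˡ-≤ k k _ (≤-pred (begin
      suc (k + k)                                          ≤⟨ bigS ⟩
      length S                                             ≡⟨ sym (length-filter-partition (Adj? p) S) ⟩
      length (neighbours p S) + length (nonNeighbours p S) ≤⟨ +-mono-≤ few (length-filter-≢ _≟_ p uN) ⟩
      k + suc (length (outside p))                         ≡⟨ +-suc k _ ⟩
      suc (k + length (outside p))                         ∎))
      where
      open ≤-Reasoning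
      uN : Unique (nonNeighbours p S)
      uN = filter⁺ _ uS

    oneEdgeOutside : ∀ {p q} → Adj G p q → length (neighbours p S) ≤ k →
      (∀ {u} → u ∈ outside p → adj G q u ≡ false) → InducedStarOrOneEdge (suc (suc k))
    oneEdgeOutside {p} {q} p~q few q≁ =
      map₂ (map₂ inj₂) (inducedOneEdge p~q (filter⁺ _ (filter⁺ _ uS))
                                       (independent-⊆ (proj₁ ∘ ∈-outside⁻) indS) away (k≤outside p few))
      where
      away : ∀ {u} → u ∈ outside p → u ≢ p × adj G p u ≡ false × adj G q u ≡ false
      away u∈ = let _ , u≢p , p≁u = ∈-outside⁻ u∈ in u≢p , p≁u , q≁ u∈

    starOr : ∀ p → (length (neighbours p S) ≤ k → InducedStarOrOneEdge (suc (suc k))) →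
      InducedStarOrOneEdge (suc (suc k))
    starOr p fewNeighbours with suc k ≤? length (neighbours p S)
    ... | yes many = map₂ (map₂ inj₁) (inducedStar (filter⁺ _ uS)
                                                   (independent-⊆ (proj₁ ∘ ∈-neighbours⁻ p S) indS)
                                                   (λ y∈ → proj₂ (∈-neighbours⁻ p S y∈)) many)
    ... | no  few  = fewNeighbours (≤-pred (≰⇒> few))

    independent+edge⇒starOrOneEdge : (∃[ a ] ∃[ b ] Adj G a b) → InducedStarOrOneEdge (suc (suc k))
    independent+edge⇒starOrOneEdge (a , b , a~b) with anyᴸ? (Adj? b) S
    ... | yes b~S = let s , s∈S , b~s = find b~S in
      starOr b (λ few → oneEdgeOutside b~s few (λ u∈ → indS s∈S (proj₁ (∈-outside⁻ u∈))))
    ... | no  b≁S =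
      starOr a (λ few → oneEdgeOutside a~b few (λ u∈ → ¬-not (b≁S ∘ lose (proj₁ (∈-outside⁻ u∈)))))

  independentIn⇒starOrOneEdge : ∀ {k xs} → ¬ IsEdgeless G → HomogeneousIn false (suc (k + k)) xs →
    InducedStarOrOneEdge (suc (suc k))
  independentIn⇒starOrOneEdge ¬E (_ , _ , uS , big , H) =
    independent+edge⇒starOrOneEdge uS (homogeneous-false⇒independent H) big (¬edgeless⇒edge ¬E)

compAdj-≢ : ∀ {n} (G : Graph n) {u v} → u ≢ v → compAdj G u v ≡ not (adj G u v)
compAdj-≢ G {u} {v} u≢v with u ≟ v
... | yes u≡v = ⊥-elim (u≢v u≡v)
... | no  _   = refl

¬complete⇒complement-¬edgeless : ∀ {n} (G : Graph n) → ¬ IsComplete G → ¬ IsEdgeless (complement G)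
¬complete⇒complement-¬edgeless G ¬K E =
  ¬K λ u v u≢v → not-injective (¬-not (subst (λ b → ¬ b ≡ true) (compAdj-≢ G u≢v) (E u v)))

clique⇒complement-independent : ∀ {n m xs} (G : Graph n) →
  HomogeneousIn G true m xs → HomogeneousIn (complement G) false m xs
clique⇒complement-independent G (S , S⊆ , uS , m≤ , K) =
  S , S⊆ , uS , m≤ , λ x∈ y∈ x≢y → trans (compAdj-≢ G x≢y) (cong not (K x∈ y∈ x≢y))

induced-complement : ∀ {n h} (G : Graph n) {f : Fin h → Fin n} → Injective _≡_ _≡_ f →
  ∀ u v → adj (induced (complement G) f) u v ≡ adj (complement (induced G f)) u v
induced-complement G {f} f-inj u v with u ≟ v
... | yes refl = adj-irrefl (complement G) (f u)
... | no  u≢v  = compAdj-≢ G (u≢v ∘ f-inj)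

starOrOneEdge-resp : ∀ {h} {J K : Graph h} → (∀ u v → adj J u v ≡ adj K u v) →
  StarOrOneEdge J → StarOrOneEdge K
starOrOneEdge-resp {J = J} {K} J≗K = map-⊎ star oneEdge
  where
  star : IsStar J → IsStar K
  star (c , centre , leaves) =
    c , (λ v v≢c → trans (sym (J≗K c v)) (centre v v≢c)) ,
    λ u v u≢c v≢c K~ → leaves u v u≢c v≢c (trans (J≗K u v) K~)
  oneEdge : HasExactlyOneEdge J → HasExactlyOneEdge K
  oneEdge (a , b , a~b , only) =
    a , b , trans (sym (J≗K a b)) a~b , λ u v K~ → only u v (trans (J≗K u v) K~)

upToComplement : ∀ {n h} (G : Graph n) →
  InducedStarOrOneEdge G h ⊎ InducedStarOrOneEdge (complement G) h →
  ∃[ f ] (Injective _≡_ _≡_ f × StarOrOneEdgeUpToComplement (induced {n} {h} G f))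
upToComplement G (inj₁ (f , f-inj , J)) = f , f-inj , [ inj₁ , inj₂ ∘ inj₁ ]′ J
upToComplement G (inj₂ (f , f-inj , J)) =
  f , f-inj , inj₂ (inj₂ (starOrOneEdge-resp {J = induced (complement G) f} {complement (induced G f)}
                                             (induced-complement G f-inj) J))

lemma3p8 : (h : ℕ) → h ≥ 1 → ∃[ N ] (∀ (n : ℕ) (G : Graph n) → n ≥ N →
               ¬ IsComplete G → ¬ IsEdgeless G →
               ∃[ f ] (Injective _≡_ _≡_ f ×
                 (IsStar (induced {n} {h} G f) ⊎ HasExactlyOneEdge (induced G f)
                  ⊎ IsStar (complement (induced G f))
                  ⊎ HasExactlyOneEdge (complement (induced G f)))))
lemma3p8 zero ()
lemma3p8 (suc zero) _ = 0 , λ n G _ _ ¬E →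
  -- the star K₁,₀; the edge is only needed to supply a vertex
  let a , _ = ¬edgeless⇒edge G ¬E in
  upToComplement G (inj₁ (map₂ (map₂ inj₁) (inducedStar G {m = 0} {a} {[]} [] (λ ()) (λ ()) z≤n)))
lemma3p8 (suc (suc k)) _ = ramseyBound M M , λ n G n≥N ¬K ¬E →
  upToComplement G (swap
    (map-⊎ (independentIn⇒starOrOneEdge (complement G) (¬complete⇒complement-¬edgeless G ¬K)
              ∘ clique⇒complement-independent G)
           (independentIn⇒starOrOneEdge G ¬E)
           (ramsey G M M (allFin⁺ n) (subst (ramseyBound M M ≤_) (sym (length-tabulate (λ i → i))) n≥N))))
  where
  M : ℕ
  M = suc (k + k)
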